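{- Let $m\ge3$ be an odd integer and let $\langle\mathbf{a},\mathbf{b}\rangle$ be an admissible pair, $\mathbf{a}=[a_0,\ldots,a_{m-1}]$, $\mathbf{b}=[b_0,\ldots,b_{m-1}]$. Set $\tilde{\mathbf{a}}=[b_i+1: 0\le i<m]$ and $\tilde{\mathbf{b}}=[a_i-1:0\le i<m]$. Then the pair $\langle\tilde{\mathbf{a}},\tilde{\mathbf{b}}\rangle$ is also admissible.
   Context: $\mathcal{N}_N=\{1-N,3-N,\ldots,N-1\}$. For odd $m\ge3$, a pair $\langle[a_0,\ldots,a_{m-1}],[b_0,\ldots,b_{m-1}]\rangle$ of integer sequences is admissible if all $a_i$ are odd integers in $\{1-2m^2,\ldots,2m^2-1\}$, all $b_i$ are even integers in $\{ -2m^2,\ldots,2m^2-2\}$, $a_0=1$, $b_0=0$, and $\{x(a_i+b_j):x\in\{ -1,1\},0\le i,j<m\}=\mathcal{N}_{2m^2}$. -}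

module Defs where

open import Data.Nat as ℕ using (ℕ)
open import Data.Integer using (ℤ; +_; -_; _+_; _-_; _*_; _≤_)
open import Data.Fin using (Fin; toℕ)
open import Data.Product using (Σ; ∃; _×_; _,_)
open import Data.Sum using (_⊎_)
open import Relation.Binary.PropositionalEquality using (_≡_)

IsOdd : ℤ → Set
IsOdd z = ∃ λ k → z ≡ + 2 * k + + 1

IsEven : ℤ → Set
IsEven z = ∃ λ k → z ≡ + 2 * k

In𝒩 : ℕ → ℤ → Set
In𝒩 N z = (+ 1 - + N ≤ z) × (z ≤ + N - + 1) × IsEven (z - (+ 1 - + N))

IsSign : ℤ → Set
IsSign x = (x ≡ + 1) ⊎ (x ≡ - + 1)

twoM² : ℕ → ℕ
twoM² m = 2 ℕ.* (m ℕ.* m)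

Admissible : (m : ℕ) → (Fin m → ℤ) → (Fin m → ℤ) → Set
Admissible m a b =
  ((i : Fin m) → IsOdd (a i) × (+ 1 - + twoM² m ≤ a i) × (a i ≤ + twoM² m - + 1))
  × ((i : Fin m) → IsEven (b i) × (- + twoM² m ≤ b i) × (b i ≤ + twoM² m - + 2))
  × ((i : Fin m) → toℕ i ≡ 0 → (a i ≡ + 1) × (b i ≡ + 0))
  × ((z : ℤ) → (Σ ℤ λ x → Σ (Fin m) λ i → Σ (Fin m) λ j →
                   IsSign x × (z ≡ x * (a i + b j)))
               → In𝒩 (twoM² m) z)
  × ((z : ℤ) → In𝒩 (twoM² m) z
               → Σ ℤ λ x → Σ (Fin m) λ i → Σ (Fin m) λ j →
                   IsSign x × (z ≡ x * (a i + b j)))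

{-# OPTIONS --safe #-}
-- Since (b_j + 1) + (a_i - 1) = a_i + b_j, the new pair has exactly the same signed sums
-- x(ã_j + b̃_i) as the old one, with the roles of the two indices exchanged; shifting by ±1
-- swaps parity and moves the even range {-2m², …, 2m²-2} onto the odd range
-- {1-2m², …, 2m²-1} and back.
module Submission where

open import Defs
open import Data.Nat using (ℕ; _≤_)
open import Data.Integer using (ℤ; +_; _+_; _-_)
open import Data.Fin using (Fin; toℕ)
open import Data.Product using (∃)
open import Relation.Binary.PropositionalEquality using (_≡_)

import Data.Integer as ℤ
open import Data.Integer.Properties using (+-monoˡ-≤)
open import Data.Integer.Tactic.RingSolver using (solve-∀)
open import Data.Product using (Σ; _×_; _,_)
open import Function using (_∘_)
open import Relation.Binary.PropositionalEquality using (refl; sym; trans; cong; subst₂)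

OddEntry : ℤ → ℤ → Set
OddEntry N z = IsOdd z × (+ 1 - N ℤ.≤ z) × (z ℤ.≤ N - + 1)

EvenEntry : ℤ → ℤ → Set
EvenEntry N z = IsEven z × (ℤ.- N ℤ.≤ z) × (z ℤ.≤ N - + 2)

SignedSum : {m : ℕ} → (Fin m → ℤ) → (Fin m → ℤ) → ℤ → Set
SignedSum {m} a b z =
  Σ ℤ λ x → Σ (Fin m) λ i → Σ (Fin m) λ j → IsSign x × (z ≡ x ℤ.* (a i + b j))

+-mono-≤-onto : ∀ {x y} c {x′ y′} → x + c ≡ x′ → y + c ≡ y′ → x ℤ.≤ y → x′ ℤ.≤ y′
+-mono-≤-onto c x+c≡x′ y+c≡y′ = subst₂ ℤ._≤_ x+c≡x′ y+c≡y′ ∘ +-monoˡ-≤ c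

evenEntry⇒oddEntry-suc : ∀ N {z} → EvenEntry N z → OddEntry N (z + + 1)
evenEntry⇒oddEntry-suc N ((k , refl) , lower , upper) =
  (k , refl) , +-mono-≤-onto (+ 1) (-N+1≡1-N N) refl lower
             , +-mono-≤-onto (+ 1) refl (N-2+1≡N-1 N) upper
  where
  -N+1≡1-N : ∀ N → ℤ.- N + + 1 ≡ + 1 - N
  -N+1≡1-N = solve-∀
  N-2+1≡N-1 : ∀ N → (N - + 2) + + 1 ≡ N - + 1
  N-2+1≡N-1 = solve-∀

oddEntry⇒evenEntry-pred : ∀ N {z} → OddEntry N z → EvenEntry N (z - + 1)
oddEntry⇒evenEntry-pred N ((k , refl) , lower , upper) =
  (k , 2k+1-1≡2k k) , +-mono-≤-onto (ℤ.- + 1) (1-N-1≡-N N) refl lower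
                    , +-mono-≤-onto (ℤ.- + 1) refl (N-1-1≡N-2 N) upper
  where
  2k+1-1≡2k : ∀ k → (+ 2 ℤ.* k + + 1) - + 1 ≡ + 2 ℤ.* k
  2k+1-1≡2k = solve-∀
  1-N-1≡-N : ∀ N → (+ 1 - N) - + 1 ≡ ℤ.- N
  1-N-1≡-N = solve-∀
  N-1-1≡N-2 : ∀ N → (N - + 1) - + 1 ≡ N - + 2
  N-1-1≡N-2 = solve-∀

signedSum-transpose : ∀ {m} {a b a′ b′ : Fin m → ℤ} {z} →
                      (∀ i j → a′ i + b′ j ≡ a j + b i) →
                      SignedSum a b z → SignedSum a′ b′ z
signedSum-transpose sum≡ (x , i , j , sign , z≡) =
  x , j , i , sign , trans z≡ (cong (x ℤ.*_) (sym (sum≡ j i)))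

shifted-sum : ∀ a b → (b + + 1) + (a - + 1) ≡ a + b
shifted-sum = solve-∀

module _ {m : ℕ} (a b : Fin m → ℤ) {z : ℤ} where

  signedSum⇒shiftedSignedSum : SignedSum a b z →
                               SignedSum (λ i → b i + + 1) (λ i → a i - + 1) z
  signedSum⇒shiftedSignedSum =
    signedSum-transpose {a = a} {b} {λ i → b i + + 1} {λ i → a i - + 1}
      (λ i j → shifted-sum (a j) (b i))

  shiftedSignedSum⇒signedSum : SignedSum (λ i → b i + + 1) (λ i → a i - + 1) z →
                               SignedSum a b z
  shiftedSignedSum⇒signedSum =
    signedSum-transpose {a = λ i → b i + + 1} {λ i → a i - + 1} {a} {b}
      (λ i j → sym (shifted-sum (a i) (b j)))

lemma3p6 : (m : ℕ) → 3 ≤ m → (∃ λ k → m ≡ 2 Data.Nat.* k Data.Nat.+ 1) →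
           (a b : Fin m → ℤ) → Admissible m a b →
           Admissible m (λ i → b i + + 1) (λ i → a i - + 1)
lemma3p6 m _ _ a b (a-odd , b-even , a₀b₀ , sums⊆𝒩 , 𝒩⊆sums) =
    evenEntry⇒oddEntry-suc N ∘ b-even
  , oddEntry⇒evenEntry-pred N ∘ a-odd
  , ã₀b̃₀
  , (λ z → sums⊆𝒩 z ∘ shiftedSignedSum⇒signedSum a b)
  , (λ z → signedSum⇒shiftedSignedSum a b ∘ 𝒩⊆sums z)
  where
  N : ℤ
  N = + twoM² m
  ã₀b̃₀ : ∀ i → toℕ i ≡ 0 → (b i + + 1 ≡ + 1) × (a i - + 1 ≡ + 0)
  ã₀b̃₀ i i≡0 with a₀b₀ i i≡0
  ... | a≡1 , b≡0 = cong (_+ + 1) b≡0 , cong (_- + 1) a≡1
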